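{- Let $S$ be a string and let $u, v$ be nodes of $\mathsf{CPH}(S)$ such that $\mathsf{rsl}(v, a) = u$. Then $a \le \sigma_S$, the number of distinct characters in $S$.
   Context: $\mathsf{PD}(X)[i] = i - \max\{j<i : X[j]\le X[i]\}$ if such $j$ exists and $0$ otherwise; $S[i..]=S[i..|S|]$. Sequence hash tree $\mathsf{SHT}(\langle w_1,\ldots,w_k\rangle)$: the trie (nodes identified with their root-to-node path labels) built from a root by adding, for $i=1,\ldots,k$, the node $w_i[1..|p_i|+1]$ as a child (edge label $w_i[|p_i|+1]$) of the longest prefix $p_i$ of $w_i$ already present. For $|S|=n$, $\mathsf{CPH}(S) = \mathsf{SHT}(\langle \mathsf{PD}(S[n..]),\ldots,\mathsf{PD}(S[1..])\rangle)$; each node is thus an integer sequence equal to the PD encoding of some substring of $S$. A position $f$ of an integer sequence $u$ is a front pointer if $f\ge 2$ and $f - u[f] = 1$; $\mathcal{F}_u$ denotes the set of front pointers of $u$. For a non-root node $u$, its suffix link $\mathsf{sl}(u)$ is the sequence obtained from $u$ by replacing $u[f]$ by $0$ for every $f\in\mathcal{F}_u$ and then removing the first entry $u[1]$ $(=0)$. For nodes $u,v$ and a nonnegative integer $a$, the reversed suffix link is $\mathsf{rsl}(v,a)=u$ iff $\mathsf{sl}(u) = v$ and $a = |\mathcal{F}_u|$. -}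

module Defs where

open import Data.Nat using (ℕ; zero; suc; _≤_; _<?_)
import Data.Nat.Properties as ℕP
open import Data.List using (List; []; _∷_; length; take; reverse; deduplicate; _++_; [_])
import Data.List.Properties as LP
open import Data.List.Membership.DecPropositional (LP.≡-dec ℕP._≟_) using (_∈?_)
open import Data.Bool using (Bool; true; false; if_then_else_)
open import Relation.Nullary using (yes; no; does)
open import Relation.Binary.Bundles using (DecTotalOrder)

module _ {c ℓ₁ ℓ₂} (O : DecTotalOrder c ℓ₁ ℓ₂) where
  open DecTotalOrder O renaming (Carrier to A)

  -- distance (1-based) to the nearest element y in a reversed prefix with y ≤ x;
  -- 0 if there is none.
  nearest : A → List A → ℕ
  nearest x [] = 0
  nearest x (y ∷ ys) with y ≤? x
  ... | yes _ = 1
  ... | no _ with nearest x ys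
  ...   | zero = 0
  ...   | suc d = suc (suc d)

  -- PD(X)[i] = i - max{ j < i : X[j] ≤ X[i] }, or 0 if no such j.
  PDgo : List A → List A → List ℕ
  PDgo rev [] = []
  PDgo rev (x ∷ xs) = nearest x rev ∷ PDgo (x ∷ rev) xs

  PD : List A → List ℕ
  PD = PDgo []

  suffixes : List A → List (List A)
  suffixes [] = []
  suffixes (x ∷ xs) = (x ∷ xs) ∷ suffixes xs

  σ : List A → ℕ
  σ S = length (deduplicate _≟_ S)

-- Sequence hash tree over integer sequences; a trie is represented by its
-- set of nodes (root-to-node path labels), the root being [].
Trie : Set
Trie = List (List ℕ)

longestPrefixUpTo : Trie → List ℕ → ℕ → ℕ
longestPrefixUpTo t w zero = 0
longestPrefixUpTo t w (suc k) with take (suc k) w ∈? t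
... | yes _ = suc k
... | no _ = longestPrefixUpTo t w k

longestPrefix : Trie → List ℕ → ℕ
longestPrefix t w = longestPrefixUpTo t w (length w)

shtInsert : Trie → List ℕ → Trie
shtInsert t w with longestPrefix t w <? length w
... | yes _ = t ++ [ take (suc (longestPrefix t w)) w ]
... | no _ = t

shtFrom : Trie → List (List ℕ) → Trie
shtFrom t [] = t
shtFrom t (w ∷ ws) = shtFrom (shtInsert t w) ws

SHT : List (List ℕ) → Trie
SHT = shtFrom ([] ∷ [])

module _ {c ℓ₁ ℓ₂} (O : DecTotalOrder c ℓ₁ ℓ₂) where
  open import Data.List using (map)

  CPH : List (DecTotalOrder.Carrier O) → Trie
  CPH S = SHT (reverse (map (PD O) (suffixes O S)))

-- front pointers: 1-based positions f ≥ 2 with f - u[f] = 1.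
-- Helper walks u with the current 1-based position i.
frontPointersFrom : ℕ → List ℕ → List ℕ
frontPointersFrom i [] = []
frontPointersFrom i (x ∷ xs) with 2 Data.Nat.≤? i | suc x ℕP.≟ i
... | yes _ | yes _ = i ∷ frontPointersFrom (suc i) xs
... | _     | _     = frontPointersFrom (suc i) xs

frontPointers : List ℕ → List ℕ
frontPointers = frontPointersFrom 1

numFront : List ℕ → ℕ
numFront u = length (frontPointers u)

zeroFrontFrom : ℕ → List ℕ → List ℕ
zeroFrontFrom i [] = []
zeroFrontFrom i (x ∷ xs) with 2 Data.Nat.≤? i | suc x ℕP.≟ i
... | yes _ | yes _ = 0 ∷ zeroFrontFrom (suc i) xs
... | _     | _     = x ∷ zeroFrontFrom (suc i) xs

sl : List ℕ → List ℕ
sl u with zeroFrontFrom 1 u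
... | [] = []
... | _ ∷ r = r

open import Relation.Binary.PropositionalEquality using (_≡_)
open import Data.Product using (_×_)

RSL : List ℕ → ℕ → List ℕ → Set
RSL v a u = (sl u ≡ v) × (a ≡ numFront u)

-- Every node of CPH(S) is the PD encoding of a string T over the characters of S, because the
-- trie only ever adds prefixes of the inserted words and PD commutes with taking prefixes.
-- A position f ≥ 2 of PD(T) is a front pointer exactly when T[1] is the nearest character
-- ≤ T[f] to its left, i.e. T[1] ≤ T[f] < T[j] for all 1 < j < f. Hence the characters at the
-- front pointers strictly decrease from left to right; being pairwise distinct characters of S,
-- there are at most σ_S of them.
module Submission where

open import Defs
open import Data.Nat using (ℕ; _≤_)
open import Data.List using (List; [])
open import Data.List.Membership.Propositional using (_∈_)
open import Relation.Binary.Bundles using (DecTotalOrder)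
open import Relation.Binary.PropositionalEquality using (_≢_)

open import Data.Nat using (zero; suc; z≤n; _<?_) renaming (_≤?_ to _≤ℕ?_)
import Data.Nat.Properties as ℕP
open import Data.List using (_∷_; _++_; [_]; length; take; map; deduplicate)
import Data.List.Properties as LP
open import Data.List.Relation.Unary.All as All using (All; []; _∷_)
import Data.List.Relation.Unary.All.Properties as AllP
open import Data.List.Relation.Unary.Any using (here; there)
import Data.List.Relation.Unary.Any.Properties as AnyP
open import Data.List.Relation.Unary.AllPairs as AllPairs using (AllPairs; []; _∷_)
import Data.List.Relation.Binary.Sublist.Propositional as Sublist
open Sublist using (_∷ʳ_)
open import Data.List.Relation.Binary.Sublist.Propositional.Properties using (All-resp-⊆)
import Data.List.Fresh as Fresh
import Data.List.Fresh.Relation.Unary.Any as FreshAny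
import Data.List.Fresh.Membership.Setoid as FreshMembership
import Data.List.Fresh.Membership.Setoid.Properties as FreshMembershipP
import Data.List.Membership.Setoid as SetoidMembership
import Data.List.Membership.Setoid.Properties as SetoidMembershipP
import Data.List.Relation.Binary.Subset.Setoid as SetoidSubset
import Data.List.Relation.Unary.Unique.Setoid as SetoidUnique
open import Data.List.Relation.Unary.Unique.DecSetoid.Properties using (deduplicate-!)
open import Data.Product using (Σ; _×_; _,_)
open import Function using (_∘_; id)
open import Level using (_⊔_)
open import Relation.Nullary using (¬_; yes; no; contradiction)
open import Relation.Binary.Bundles using (Setoid)
open import Relation.Binary.PropositionalEquality
  using (_≡_; refl; sym; trans; cong; subst₂)

PrefixClosed : ∀ {p} → (List ℕ → Set p) → Set p
PrefixClosed P = ∀ k {w} → P w → P (take k w)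

module _ {p} {P : List ℕ → Set p} (P-take : PrefixClosed P) where

  All-shtInsert : ∀ {t w} → All P t → P w → All P (shtInsert t w)
  All-shtInsert {t} {w} Pt Pw with longestPrefix t w <? length w
  ... | yes _ = AllP.++⁺ Pt (P-take _ Pw ∷ [])
  ... | no _ = Pt

  All-shtFrom : ∀ {t} ws → All P t → All P ws → All P (shtFrom t ws)
  All-shtFrom []       Pt _           = Pt
  All-shtFrom (w ∷ ws) Pt (Pw ∷ Pws) = All-shtFrom ws (All-shtInsert Pt Pw) Pws

  All-SHT : ∀ {ws} → P [] → All P ws → All P (SHT ws)
  All-SHT P[] = All-shtFrom _ (P[] ∷ [])

module _ {a ℓ} (S : Setoid a ℓ) where
  open SetoidMembership S using () renaming (_∈_ to _∈ₛ_)
  open SetoidSubset S using (_⊆_)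
  open SetoidUnique S using (Unique)
  private module F = FreshMembership S

  private
    ∈-fromList⁺ : ∀ {x xs} (! : Unique xs) → x ∈ₛ xs → x F.∈ Fresh.fromList !
    ∈-fromList⁺ (_ ∷ _) (here x≈y)  = FreshAny.here x≈y
    ∈-fromList⁺ (_ ∷ !) (there x∈) = FreshAny.there (∈-fromList⁺ ! x∈)

    ∈-fromList⁻ : ∀ {x xs} (! : Unique xs) → x F.∈ Fresh.fromList ! → x ∈ₛ xs
    ∈-fromList⁻ (_ ∷ _) (FreshAny.here x≈y)  = here x≈y
    ∈-fromList⁻ (_ ∷ !) (FreshAny.there x∈) = there (∈-fromList⁻ ! x∈)

    length-fromList : ∀ {xs} (! : Unique xs) → Fresh.length (Fresh.fromList !) ≡ length xs
    length-fromList []      = refl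
    length-fromList (_ ∷ !) = cong suc (length-fromList !)

  Unique-⊆⇒length-≤ : ∀ {xs ys} → Unique xs → Unique ys → xs ⊆ ys → length xs ≤ length ys
  Unique-⊆⇒length-≤ !xs !ys xs⊆ys =
    subst₂ _≤_ (length-fromList !xs) (length-fromList !ys)
      (FreshMembershipP.injection S id (∈-fromList⁺ !ys ∘ xs⊆ys ∘ ∈-fromList⁻ !xs))

module _ {c ℓ₁ ℓ₂} (O : DecTotalOrder c ℓ₁ ℓ₂) where
  open DecTotalOrder O using (module Eq; _≤?_; reflexive) renaming (Carrier to A; _≤_ to _⊑_)
  open SetoidMembership Eq.setoid using () renaming (_∈_ to _∈ₛ_)

  take-PDgo : ∀ k rev (xs : List A) → take k (PDgo O rev xs) ≡ PDgo O rev (take k xs)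
  take-PDgo zero    rev xs       = refl
  take-PDgo (suc k) rev []       = refl
  take-PDgo (suc k) rev (x ∷ xs) = cong (nearest O x rev ∷_) (take-PDgo k (x ∷ rev) xs)

  PDOver : List A → List ℕ → Set (c ⊔ ℓ₁)
  PDOver S w = Σ (List A) λ T → All (_∈ₛ S) T × PD O T ≡ w

  PDOver-take : ∀ {S} → PrefixClosed (PDOver S)
  PDOver-take k (T , T⊆S , refl) = take k T , AllP.take⁺ k T⊆S , sym (take-PDgo k [] T)

  All-suffixes : ∀ {p} {P : A → Set p} {xs} → All P xs → All (All P) (suffixes O xs)
  All-suffixes []         = []
  All-suffixes (px ∷ pxs) = (px ∷ pxs) ∷ All-suffixes pxs

  CPH-PDOver : ∀ S → All (PDOver S) (CPH O S)
  CPH-PDOver S = All-SHT PDOver-take ([] , [] , refl)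
    (All.tabulate (All.lookup PD-suffixes ∘ AnyP.reverse⁻))
    where
    PD-suffixes : All (PDOver S) (map (PD O) (suffixes O S))
    PD-suffixes = AllP.map⁺ (All.map (λ T⊆S → _ , T⊆S , refl)
                                     (All-suffixes (All.tabulateₛ Eq.setoid id)))

  frontCharsFrom : ℕ → List A → List A → List A
  frontCharsFrom i rev []       = []
  frontCharsFrom i rev (x ∷ xs) with 2 ≤ℕ? i | suc (nearest O x rev) ℕP.≟ i
  ... | yes _ | yes _ = x ∷ frontCharsFrom (suc i) (x ∷ rev) xs
  ... | _     | _     = frontCharsFrom (suc i) (x ∷ rev) xs

  length-frontPointersFrom : ∀ i rev xs →
    length (frontPointersFrom i (PDgo O rev xs)) ≡ length (frontCharsFrom i rev xs)
  length-frontPointersFrom i rev []       = refl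
  length-frontPointersFrom i rev (x ∷ xs) with 2 ≤ℕ? i | suc (nearest O x rev) ℕP.≟ i
  ... | yes _ | yes _ = cong suc (length-frontPointersFrom (suc i) (x ∷ rev) xs)
  ... | yes _ | no _  = length-frontPointersFrom (suc i) (x ∷ rev) xs
  ... | no _  | _     = length-frontPointersFrom (suc i) (x ∷ rev) xs

  frontCharsFrom-⊆ : ∀ i rev xs → frontCharsFrom i rev xs Sublist.⊆ xs
  frontCharsFrom-⊆ i rev []       = Sublist.[]
  frontCharsFrom-⊆ i rev (x ∷ xs) with 2 ≤ℕ? i | suc (nearest O x rev) ℕP.≟ i
  ... | yes _ | yes _ = refl Sublist.∷ frontCharsFrom-⊆ (suc i) (x ∷ rev) xs
  ... | yes _ | no _  = x ∷ʳ frontCharsFrom-⊆ (suc i) (x ∷ rev) xs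
  ... | no _  | _     = x ∷ʳ frontCharsFrom-⊆ (suc i) (x ∷ rev) xs

  -- Along the PD walk of t ∷ T the reversed prefix has the shape r ++ [ t ], so a front
  -- pointer is a character y whose nearest predecessor ≤ y is t itself.
  nearest≡length⇒All⋢ : ∀ y r t →
    nearest O y (r ++ [ t ]) ≡ length (r ++ [ t ]) → All (λ x → ¬ x ⊑ y) r
  nearest≡length⇒All⋢ y []      t _  = []
  nearest≡length⇒All⋢ y (x ∷ r) t eq with x ≤? y
  ... | yes _ = contradiction (ℕP.suc-injective (sym eq)) length-r++t≢0
    where
    length-r++t≢0 : length (r ++ [ t ]) ≢ 0
    length-r++t≢0 rewrite LP.length-++-sucʳ r t [] = λ ()
  ... | no x⋢y with nearest O y (r ++ [ t ]) in near
  ...   | suc d = x⋢y ∷ nearest≡length⇒All⋢ y r t (trans near (ℕP.suc-injective eq))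

  frontChars-below : ∀ {x} r t xs → x ∈ r →
    All (λ y → ¬ x ⊑ y) (frontCharsFrom (suc (length (r ++ [ t ]))) (r ++ [ t ]) xs)
  frontChars-below r t []       x∈r = []
  frontChars-below r t (y ∷ xs) x∈r
    with 2 ≤ℕ? suc (length (r ++ [ t ])) | suc (nearest O y (r ++ [ t ])) ℕP.≟ suc (length (r ++ [ t ]))
  ... | yes _ | yes eq = All.lookup (nearest≡length⇒All⋢ y r t (ℕP.suc-injective eq)) x∈r
                         ∷ frontChars-below (y ∷ r) t xs (there x∈r)
  ... | yes _ | no _   = frontChars-below (y ∷ r) t xs (there x∈r)
  ... | no _  | _      = frontChars-below (y ∷ r) t xs (there x∈r)

  frontChars-descending : ∀ r t xs →
    AllPairs (λ x y → ¬ x ⊑ y) (frontCharsFrom (suc (length (r ++ [ t ]))) (r ++ [ t ]) xs)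
  frontChars-descending r t []       = []
  frontChars-descending r t (x ∷ xs)
    with 2 ≤ℕ? suc (length (r ++ [ t ])) | suc (nearest O x (r ++ [ t ])) ℕP.≟ suc (length (r ++ [ t ]))
  ... | yes _ | yes _ = frontChars-below (x ∷ r) t xs (here refl) ∷ frontChars-descending (x ∷ r) t xs
  ... | yes _ | no _  = frontChars-descending (x ∷ r) t xs
  ... | no _  | _     = frontChars-descending (x ∷ r) t xs

  numFront-PD≤σ : ∀ {S T} → All (_∈ₛ S) T → numFront (PD O T) ≤ σ O S
  numFront-PD≤σ             []         = z≤n
  numFront-PD≤σ {S} {t ∷ T} (_ ∷ T⊆S) = begin
    numFront (PD O (t ∷ T))             ≡⟨ length-frontPointersFrom 2 [ t ] T ⟩
    length (frontCharsFrom 2 [ t ] T)   ≤⟨ Unique-⊆⇒length-≤ Eq.setoid fronts-unique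
                                             (deduplicate-! Eq.decSetoid S) fronts⊆S ⟩
    σ O S                               ∎
    where
    open ℕP.≤-Reasoning

    fronts-unique : AllPairs (λ x y → ¬ x Eq.≈ y) (frontCharsFrom 2 [ t ] T)
    fronts-unique = AllPairs.map (λ x⋢y x≈y → x⋢y (reflexive x≈y)) (frontChars-descending [] t T)

    fronts⊆S : ∀ {x} → x ∈ₛ frontCharsFrom 2 [ t ] T → x ∈ₛ deduplicate Eq._≟_ S
    fronts⊆S = SetoidMembershipP.∈-deduplicate⁺ Eq.setoid Eq._≟_ (λ y≈z x≈y → Eq.trans x≈y (Eq.sym y≈z))
             ∘ All.lookupₛ Eq.setoid (SetoidMembershipP.∈-resp-≈ Eq.setoid)
                 (All-resp-⊆ (frontCharsFrom-⊆ 2 [ t ] T) T⊆S)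

lemma4 : ∀ {c ℓ₁ ℓ₂} (O : DecTotalOrder c ℓ₁ ℓ₂)
    (S : List (DecTotalOrder.Carrier O)) (u v : List ℕ) (a : ℕ) →
    u ∈ CPH O S → v ∈ CPH O S → u ≢ [] →
    RSL v a u → a ≤ σ O S
lemma4 O S u v a u∈CPH _ _ (_ , refl) with All.lookup (CPH-PDOver O S) u∈CPH
... | T , T⊆S , refl = numFront-PD≤σ O T⊆S
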